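{- Let $n\ge1$ and consider the Ziggu state graph on $n$ digits (defined in the context). Let $c_1,c_2,\dots,c_N$ be the sequence of indices of the digits changed by the successive moves of the shortest solution, so that the $j$-th move changes digit $q_{c_j}$. Then $|c_{j+1}-c_j|\le 1$ for all $1\le j<N$.
   Context: Write strings over $\{0,1,2,3\}$ as $q=q_nq_{n-1}\cdots q_1$, where $q_1$ is the rightmost digit. A state is such a string in which every digit to the right of a $3$ is also a $3$. Two states $q,q'$ are adjacent (one move apart) iff they agree except in one position $i$, where $\{q_i,q'_i\}=\{a,a+1\}$ for some $a\in\{0,1,2\}$, and, if $i\ge2$, the common digit $q_{i-1}$ equals $3$ when $a$ is even and equals $0$ when $a$ is odd. A solution is a sequence of pairwise distinct states from $0^n$ to $3^n$ in which consecutive states are adjacent. The shortest solution is the unique solution with the fewest states. -}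

module Defs where

open import Data.Nat using (ℕ; zero; suc; _<_; _≤_; _%_; ∣_-_∣)
open import Data.Fin using (Fin; zero; suc; toℕ; inject₁)
open import Data.Vec using (Vec; lookup; replicate)
open import Data.List using (List; []; _∷_; _++_; length; head; last)
open import Data.List.Relation.Unary.All using (All)
open import Data.List.Relation.Unary.Unique.Propositional using (Unique)
open import Data.List.Relation.Unary.Linked using (Linked)
open import Data.Maybe using (just)
open import Data.Product using (Σ; _×_; ∃)
open import Data.Sum using (_⊎_)
open import Relation.Binary.PropositionalEquality using (_≡_; _≢_)
open import Relation.Nullary using (¬_)
open import Data.Unit using (⊤)

Digit : Set
Digit = Fin 4

d0 d3 : Digit
d0 = zero
d3 = suc (suc (suc zero))

-- A string q = q_n ... q_1 is a vector; position k : Fin n holds the digit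
-- q_{toℕ k + 1}.  So position 0 is the rightmost digit q_1.
Str : ℕ → Set
Str n = Vec Digit n

dig : ∀ {n} → Str n → Fin n → Digit
dig q k = lookup q k

IsState : ∀ {n} → Str n → Set
IsState {n} q = ∀ (i j : Fin n) → toℕ j < toℕ i → dig q i ≡ d3 → dig q j ≡ d3

Even : ℕ → Set
Even m = m % 2 ≡ 0

StepPair : Fin 3 → Digit → Digit → Set
StepPair a x y = (x ≡ inject₁ a × y ≡ suc a) ⊎ (x ≡ suc a × y ≡ inject₁ a)

RightCond : ∀ {n} → Str n → Fin n → Fin 3 → Set
RightCond q zero    a = ⊤
RightCond q (suc k) a =
  (Even (toℕ a) → dig q (inject₁ k) ≡ d3) × (¬ Even (toℕ a) → dig q (inject₁ k) ≡ d0)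

MoveAt : ∀ {n} → Fin n → Str n → Str n → Set
MoveAt {n} k q q' =
  (∀ (j : Fin n) → j ≢ k → dig q j ≡ dig q' j) ×
  Σ (Fin 3) (λ a → StepPair a (dig q k) (dig q' k) × RightCond q k a)

Adjacent : ∀ {n} → Str n → Str n → Set
Adjacent {n} q q' = ∃ λ (k : Fin n) → MoveAt k q q'

record Solution (n : ℕ) (s : List (Str n)) : Set where
  field
    states   : All IsState s
    distinct : Unique s
    steps    : Linked Adjacent s
    start    : head s ≡ just (replicate n d0)
    finish   : last s ≡ just (replicate n d3)

Shortest : (n : ℕ) → List (Str n) → Set
Shortest n s = Solution n s × (∀ (t : List (Str n)) → Solution n t → length s ≤ length t)

-- Three functions on states, the distances from 0…0, to 3…3 and to the gate 0 3…3, can be written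
-- down by recursion on the leading digit, and each changes by at most one per move.  An explicit
-- solution with span n moves bounds the length of the shortest one, and these bounds then pin every
-- state of the shortest solution to a geodesic: the distance from 0…0 rises by exactly one per move
-- while its sum with the distance to 3…3 stays span n.  On such a geodesic the leading digit
-- determines how the lower digits move (again along a geodesic, from 0…0 to 3…3 or between 3…3 and
-- the gate), so two consecutive moves either both leave the leading digit alone, and induction on n
-- applies, or one of them moves it; the other then has to reach or leave a lower part that is 3…3
-- or has leading digit 0, and so moves the digit just below the leading one.

module Submission where

open import Defs
open import Algebra.Properties.CommutativeSemigroup using (x∙yz≈y∙xz)
open import Data.Empty using (⊥; ⊥-elim)
open import Data.Fin using (Fin; zero; suc; toℕ; inject₁; fromℕ)
import Data.Fin.Properties as Fin
open import Data.Fin.Relation.Unary.Top using (View; view; ‵fromℕ; ‵inject₁)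
open import Data.List as List using (List; []; _∷_; _++_; length)
open import Data.List.Relation.Unary.All using (All; []; _∷_)
import Data.List.Relation.Unary.All.Properties as All
import Data.List.Relation.Unary.AllPairs as AllPairs
open import Data.List.Relation.Unary.Linked as Linked using (Linked; []; [-]; _∷_)
open import Data.List.Relation.Unary.Linked.Properties using (Linked⇒AllPairs)
open import Data.Maybe using (just)
open import Data.Nat using (ℕ; zero; suc; _+_; _⊔_; _≤_; _<_; z≤n; s≤s; s≤s⁻¹; ∣_-_∣)
open import Data.Nat.Properties
open import Data.Nat.Tactic.RingSolver using (solve-∀)
open import Data.Product using (Σ; _×_; _,_; proj₁; proj₂)
open import Data.Sum using (_⊎_; inj₁; inj₂)
open import Data.Unit using (⊤; tt)
open import Data.Vec using (Vec; []; _∷_; lookup; replicate; _∷ʳ_; init; last)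
open import Data.Vec.Properties using (lookup-replicate; init-∷ʳ; last-∷ʳ; tabulate∘lookup; tabulate-cong)
open import Function using (_∘_)
open import Relation.Binary.Construct.Closure.ReflexiveTransitive as Star using (Star; ε; _◅_; _◅◅_; gmap)
open import Relation.Binary.PropositionalEquality
  using (_≡_; _≢_; ≢-sym; refl; sym; trans; cong; cong₂; subst; subst₂; module ≡-Reasoning)
open import Relation.Nullary using (¬_)

lookup-inject₁ : ∀ {A : Set} {n} (p : Vec A (suc n)) (k : Fin n) → lookup p (inject₁ k) ≡ lookup (init p) k
lookup-inject₁ (x ∷ y ∷ ys) zero    = refl
lookup-inject₁ (x ∷ y ∷ ys) (suc k) = lookup-inject₁ (y ∷ ys) k

lookup-fromℕ : ∀ {A : Set} {n} (p : Vec A (suc n)) → lookup p (fromℕ n) ≡ last p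
lookup-fromℕ (x ∷ [])     = refl
lookup-fromℕ (x ∷ y ∷ ys) = lookup-fromℕ (y ∷ ys)

lookup-∷ʳ-inject₁ : ∀ {A : Set} {n} (x : Vec A n) t k → lookup (x ∷ʳ t) (inject₁ k) ≡ lookup x k
lookup-∷ʳ-inject₁ x t k = trans (lookup-inject₁ (x ∷ʳ t) k) (cong (λ v → lookup v k) (init-∷ʳ t x))

lookup-∷ʳ-fromℕ : ∀ {A : Set} {n} (x : Vec A n) t → lookup (x ∷ʳ t) (fromℕ n) ≡ t
lookup-∷ʳ-fromℕ x t = trans (lookup-fromℕ (x ∷ʳ t)) (last-∷ʳ t x)

last-replicate : ∀ {A : Set} n (d : A) → last (replicate (suc n) d) ≡ d
last-replicate zero    d = refl
last-replicate (suc n) d = last-replicate n d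

init-replicate : ∀ {A : Set} n (d : A) → init (replicate (suc n) d) ≡ replicate n d
init-replicate zero    d = refl
init-replicate (suc n) d = cong (d ∷_) (init-replicate n d)

replicate-∷ʳ : ∀ {A : Set} n (d : A) → replicate (suc n) d ≡ replicate n d ∷ʳ d
replicate-∷ʳ zero    d = refl
replicate-∷ʳ (suc n) d = cong (d ∷_) (replicate-∷ʳ n d)

lookup-extensional : ∀ {A : Set} {n} (x y : Vec A n) → (∀ j → lookup x j ≡ lookup y j) → x ≡ y
lookup-extensional x y h =
  trans (sym (tabulate∘lookup x)) (trans (tabulate-cong h) (tabulate∘lookup y))

d1 d2 : Digit
d1 = suc zero
d2 = suc (suc zero)

threes zeros : ∀ m → Str m
threes m = replicate m d3
zeros  m = replicate m d0

-- The condition for moving between 1 and 2 one digit higher up; vacuous on the empty string.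
Lead0 : ∀ {m} → Str m → Set
Lead0 {zero}  _ = ⊤
Lead0 {suc m} x = last x ≡ d0

threes-IsState : ∀ m → IsState (threes m)
threes-IsState m i j _ _ = lookup-replicate j d3

zeros-IsState : ∀ m → IsState (zeros m)
zeros-IsState m i j _ e with trans (sym (lookup-replicate i d0)) e
... | ()

IsState-init : ∀ {m} (p : Str (suc m)) → IsState p → IsState (init p)
IsState-init p st i j j<i e =
  trans (sym (lookup-inject₁ p j))
        (st (inject₁ i) (inject₁ j) (subst₂ _<_ (sym (Fin.toℕ-inject₁ j)) (sym (Fin.toℕ-inject₁ i)) j<i)
            (trans (lookup-inject₁ p i) e))

IsState-∷ʳ : ∀ {m} (x : Str m) t → IsState x → t ≢ d3 → IsState (x ∷ʳ t)
IsState-∷ʳ {m} x t st t≢3 i j = go (view i) (view j)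
  where
  go : ∀ {i j} → View i → View j → toℕ j < toℕ i → lookup (x ∷ʳ t) i ≡ d3 → lookup (x ∷ʳ t) j ≡ d3
  go ‵fromℕ _ _ e = ⊥-elim (t≢3 (trans (sym (lookup-∷ʳ-fromℕ x t)) e))
  go (‵inject₁ i) ‵fromℕ j<i _ =
    ⊥-elim (<-asym (subst₂ _<_ (Fin.toℕ-fromℕ m) (Fin.toℕ-inject₁ i) j<i) (Fin.toℕ<n i))
  go (‵inject₁ i) (‵inject₁ j) j<i e =
    trans (lookup-∷ʳ-inject₁ x t j)
          (st i j (subst₂ _<_ (Fin.toℕ-inject₁ j) (Fin.toℕ-inject₁ i) j<i)
                  (trans (sym (lookup-∷ʳ-inject₁ x t i)) e))

last≡3⇒threes : ∀ {m} (p : Str (suc m)) → IsState p → last p ≡ d3 → p ≡ threes (suc m)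
last≡3⇒threes {m} p st e =
  lookup-extensional p (threes (suc m)) λ j → trans (go (view j)) (sym (lookup-replicate j d3))
  where
  top3 : lookup p (fromℕ m) ≡ d3
  top3 = trans (lookup-fromℕ p) e
  go : ∀ {j} → View j → lookup p j ≡ d3
  go ‵fromℕ       = top3
  go (‵inject₁ k) =
    st (fromℕ m) (inject₁ k) (subst₂ _<_ (sym (Fin.toℕ-inject₁ k)) (sym (Fin.toℕ-fromℕ m)) (Fin.toℕ<n k)) top3

inject₁≢suc : ∀ {n} (k : Fin n) → inject₁ k ≢ suc k
inject₁≢suc k e = 1+n≢n (sym (trans (sym (Fin.toℕ-inject₁ k)) (cong toℕ e)))

StepPair-sym : ∀ {a x y} → StepPair a x y → StepPair a y x
StepPair-sym (inj₁ (e , e′)) = inj₂ (e′ , e)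
StepPair-sym (inj₂ (e , e′)) = inj₁ (e′ , e)

StepPair-irrefl : ∀ {a x} → ¬ StepPair a x x
StepPair-irrefl {a} (inj₁ (e , e′)) = inject₁≢suc a (trans (sym e) e′)
StepPair-irrefl {a} (inj₂ (e , e′)) = inject₁≢suc a (trans (sym e′) e)

RightCond-cong : ∀ {n} {p q : Str n} k {a} → (∀ j → j ≢ k → dig p j ≡ dig q j) →
                 RightCond p k a → RightCond q k a
RightCond-cong zero    _    _  = tt
RightCond-cong (suc k) same rc rewrite sym (same (inject₁ k) (inject₁≢suc k)) = rc

MoveAt-sym : ∀ {n} {k : Fin n} {p q} → MoveAt k p q → MoveAt k q p
MoveAt-sym {k = k} (same , a , pair , rc) =
  (λ j j≢k → sym (same j j≢k)) , a , StepPair-sym pair , RightCond-cong k same rc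

MoveAt-irrefl : ∀ {n} {k : Fin n} {p} → ¬ MoveAt k p p
MoveAt-irrefl (_ , _ , pair , _) = StepPair-irrefl pair

MoveAt-last : ∀ {m} {k : Fin m} {p q : Str (suc m)} → MoveAt (inject₁ k) p q → last p ≡ last q
MoveAt-last {m} {p = p} {q} (same , _) =
  trans (sym (lookup-fromℕ p)) (trans (same (fromℕ m) Fin.fromℕ≢inject₁) (lookup-fromℕ q))

-- Splitting off the leading digit

-- The leading digit q_{m+1} is the last entry of the vector.
unsnoc : ∀ {m} → Str (suc m) → Digit × Str m
unsnoc p = last p , init p

-- What the lower digits must be for the leading digit to move between a and a+1.
Precondition : ∀ {m} → Str m → Fin 3 → Set
Precondition {m} x zero             = x ≡ threes m
Precondition     x (suc zero)       = Lead0 x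
Precondition {m} x (suc (suc zero)) = x ≡ threes m

TopMove : ∀ {m} → Str m → Digit → Digit → Set
TopMove x u v = Σ (Fin 3) λ a → StepPair a u v × Precondition x a

data Move⁺ (m : ℕ) : Fin (suc m) → Digit × Str m → Digit × Str m → Set where
  low : ∀ {t t′ x y} (k : Fin m) → t ≡ t′ → MoveAt k x y → Move⁺ m (inject₁ k) (t , x) (t′ , y)
  top : ∀ {u v x y} → x ≡ y → TopMove x u v → Move⁺ m (fromℕ m) (u , x) (v , y)

digit-below-top : ∀ {m} (p : Str (suc (suc m))) → dig p (inject₁ (fromℕ m)) ≡ last (init p)
digit-below-top {m} p = trans (lookup-inject₁ p (fromℕ m)) (lookup-fromℕ (init p))

precondition : ∀ {m} (p : Str (suc m)) → IsState p → ∀ a → RightCond p (fromℕ m) a → Precondition (init p) a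
precondition {zero}  (_ ∷ []) _  zero             _        = refl
precondition {zero}  (_ ∷ []) _  (suc zero)       _        = tt
precondition {zero}  (_ ∷ []) _  (suc (suc zero)) _        = refl
precondition {suc m} p        st zero             (even , _) =
  last≡3⇒threes (init p) (IsState-init p st) (trans (sym (digit-below-top p)) (even refl))
precondition {suc m} p        _  (suc zero)       (_ , odd) = trans (sym (digit-below-top p)) (odd (λ ()))
precondition {suc m} p        st (suc (suc zero)) (even , _) =
  last≡3⇒threes (init p) (IsState-init p st) (trans (sym (digit-below-top p)) (even refl))

MoveAt-decompose : ∀ {m c} (p q : Str (suc m)) → IsState p → MoveAt c p q → Move⁺ m c (unsnoc p) (unsnoc q)
MoveAt-decompose {m} {c} p q st mv = go (view c) mv
  where
  go : ∀ {c} → View c → MoveAt c p q → Move⁺ m c (unsnoc p) (unsnoc q)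
  go (‵inject₁ k) mv@(same , a , pair , rc) =
    low k (MoveAt-last {p = p} {q} mv)
      ( (λ j j≢k → trans (sym (lookup-inject₁ p j))
                     (trans (same (inject₁ j) (j≢k ∘ Fin.inject₁-injective)) (lookup-inject₁ q j)))
      , a , subst₂ (StepPair a) (lookup-inject₁ p k) (lookup-inject₁ q k) pair , lowerRightCond k rc)
    where
    lowerRightCond : ∀ k → RightCond p (inject₁ k) a → RightCond (init p) k a
    lowerRightCond zero    _ = tt
    lowerRightCond (suc k) rc rewrite lookup-inject₁ p (inject₁ k) = rc
  go ‵fromℕ (same , a , pair , rc) =
    top (lookup-extensional (init p) (init q) λ j →
           trans (sym (lookup-inject₁ p j))
             (trans (same (inject₁ j) (Fin.fromℕ≢inject₁ ∘ sym)) (lookup-inject₁ q j)))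
        (a , subst₂ (StepPair a) (lookup-fromℕ p) (lookup-fromℕ q) pair , precondition p st a rc)

-- Distance functions

-- gap m is the distance between 3…3 and gate m, and span m the distance between 0…0 and 3…3.
gap : ℕ → ℕ
gap zero    = 0
gap (suc m) = 3 + (gap m + gap m)

span : ℕ → ℕ
span zero    = 0
span (suc m) = gap (suc m) + span m

-- The state 0 3…3: the state with leading digit 0 nearest to 3…3.
gate : ∀ m → Str m
gate zero    = []
gate (suc m) = threes m ∷ʳ d0

-- For states x on m digits, to3 m x, toGate m x and from0 m x are the graph distances from x to 3…3,
-- from x to gate m, and from 0…0 to x; to3via0 m x is the length of a shortest walk from x to 3…3
-- through a state with leading digit 0.  The proof only uses their values at 0…0, gate m and 3…3
-- and that they change by at most one per move.
mutual
  to3 toGate to3via0 : ∀ m → Str m → ℕ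
  to3 zero    _ = 0
  to3 (suc m) p = to3⁺ m (unsnoc p)

  toGate zero    _ = 0
  toGate (suc m) p = toGate⁺ m (unsnoc p)

  to3via0 m x = to3 m x ⊔ (gap m + toGate m x)

  to3⁺ toGate⁺ : ∀ m → Digit × Str m → ℕ
  to3⁺ m (zero , x)                = gap (suc m) + to3 m x
  to3⁺ m (suc zero , x)             = 2 + to3via0 m x
  to3⁺ m (suc (suc zero) , x)       = 1 + to3 m x
  to3⁺ m (suc (suc (suc zero)) , x) = 0

  toGate⁺ m (zero , x)                = 0
  toGate⁺ m (suc zero , x)             = 1 + to3 m x
  toGate⁺ m (suc (suc zero) , x)       = 2 + to3via0 m x
  toGate⁺ m (suc (suc (suc zero)) , x) = gap (suc m)

from0 : ∀ m → Str m → ℕ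
from0⁺ : ∀ m → Digit × Str m → ℕ
from0 zero    _ = 0
from0 (suc m) p = from0⁺ m (unsnoc p)

from0⁺ m (zero , x)                = from0 m x
from0⁺ m (suc zero , x)             = 1 + (span m + to3 m x)
from0⁺ m (suc (suc zero) , x)       = 2 + (span m + to3via0 m x)
from0⁺ m (suc (suc (suc zero)) , x) = span (suc m)

unsnoc-∷ʳ : ∀ {m} (x : Str m) t → unsnoc (x ∷ʳ t) ≡ (t , x)
unsnoc-∷ʳ x t = cong₂ _,_ (last-∷ʳ t x) (init-∷ʳ t x)

unsnoc-threes : ∀ m → unsnoc (threes (suc m)) ≡ (d3 , threes m)
unsnoc-threes m = cong₂ _,_ (last-replicate m d3) (init-replicate m d3)

unsnoc-zeros : ∀ m → unsnoc (zeros (suc m)) ≡ (d0 , zeros m)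
unsnoc-zeros m = cong₂ _,_ (last-replicate m d0) (init-replicate m d0)

to3-threes : ∀ m → to3 m (threes m) ≡ 0
to3-threes zero    = refl
to3-threes (suc m) = cong (to3⁺ m) (unsnoc-threes m)

toGate-threes : ∀ m → toGate m (threes m) ≡ gap m
toGate-threes zero    = refl
toGate-threes (suc m) = cong (toGate⁺ m) (unsnoc-threes m)

from0-threes : ∀ m → from0 m (threes m) ≡ span m
from0-threes zero    = refl
from0-threes (suc m) = cong (from0⁺ m) (unsnoc-threes m)

to3via0-threes : ∀ m → to3via0 m (threes m) ≡ gap m + gap m
to3via0-threes m rewrite to3-threes m | toGate-threes m = refl

to3-zeros : ∀ m → to3 m (zeros m) ≡ span m
to3-zeros zero    = refl
to3-zeros (suc m) rewrite unsnoc-zeros m | to3-zeros m = refl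

from0-zeros : ∀ m → from0 m (zeros m) ≡ 0
from0-zeros zero    = refl
from0-zeros (suc m) rewrite unsnoc-zeros m = from0-zeros m

toGate-Lead0 : ∀ m {x : Str m} → Lead0 x → toGate m x ≡ 0
toGate-Lead0 zero    _ = refl
toGate-Lead0 (suc m) e rewrite e = refl

OnGateGeodesic : ∀ m → Str m → Set
OnGateGeodesic m x = to3 m x + toGate m x ≡ gap m

r+r≤[a⊔r+z]+a : ∀ {r a z} → r ≤ a + z → r + r ≤ (a ⊔ (r + z)) + a
r+r≤[a⊔r+z]+a {r} {a} {z} r≤a+z = begin
  r + r         ≤⟨ +-monoʳ-≤ r r≤a+z ⟩
  r + (a + z)   ≡⟨ cong (r +_) (+-comm a z) ⟩
  r + (z + a)   ≡⟨ +-assoc r z a ⟨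
  (r + z) + a   ≤⟨ +-monoˡ-≤ a (m≤n⊔m a (r + z)) ⟩
  (a ⊔ (r + z)) + a ∎
  where open ≤-Reasoning

+-middle₁ : ∀ v a → (2 + v) + (1 + a) ≡ 3 + (v + a)
+-middle₁ = solve-∀

+-middle₂ : ∀ v a → (1 + a) + (2 + v) ≡ 3 + (v + a)
+-middle₂ = solve-∀

+-middle₁-span : ∀ s v a → (1 + (s + a)) + (2 + v) ≡ (3 + (v + a)) + s
+-middle₁-span = solve-∀

+-middle₂-span : ∀ s v a → (2 + (s + v)) + (1 + a) ≡ (3 + (v + a)) + s
+-middle₂-span = solve-∀

mutual
  gap≤to3+toGate : ∀ m x → gap m ≤ to3 m x + toGate m x
  gap≤to3+toGate zero    _ = z≤n
  gap≤to3+toGate (suc m) p = go (unsnoc p)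
    where
    go : ∀ P → gap (suc m) ≤ to3⁺ m P + toGate⁺ m P
    go (zero , x)                = ≤-trans (m≤m+n _ (to3 m x)) (m≤m+n _ 0)
    go (suc zero , x)            =
      subst (gap (suc m) ≤_) (sym (+-middle₁ _ _)) (+-monoʳ-≤ 3 (gap+gap≤to3via0+to3 m x))
    go (suc (suc zero) , x)      =
      subst (gap (suc m) ≤_) (sym (+-middle₂ _ _)) (+-monoʳ-≤ 3 (gap+gap≤to3via0+to3 m x))
    go (suc (suc (suc zero)) , x) = ≤-refl

  gap+gap≤to3via0+to3 : ∀ m x → gap m + gap m ≤ to3via0 m x + to3 m x
  gap+gap≤to3via0+to3 m x = r+r≤[a⊔r+z]+a {a = to3 m x} (gap≤to3+toGate m x)

Lead0⇒to3via0≤to3 : ∀ m {x} → Lead0 x → to3via0 m x ≤ to3 m x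
Lead0⇒to3via0≤to3 m {x} z = ⊔-lub ≤-refl (begin
  gap m + toGate m x ≡⟨ cong (gap m +_) (toGate-Lead0 m z) ⟩
  gap m + 0          ≡⟨ +-identityʳ _ ⟩
  gap m              ≤⟨ gap≤to3+toGate m x ⟩
  to3 m x + toGate m x ≡⟨ cong (to3 m x +_) (toGate-Lead0 m z) ⟩
  to3 m x + 0        ≡⟨ +-identityʳ _ ⟩
  to3 m x ∎)
  where open ≤-Reasoning

OnGateGeodesic⇒to3via0 : ∀ m {x} → OnGateGeodesic m x → to3via0 m x ≡ gap m + toGate m x
OnGateGeodesic⇒to3via0 m {x} on =
  m≤n⇒m⊔n≡n (≤-trans (m≤m+n (to3 m x) (toGate m x)) (≤-trans (≤-reflexive on) (m≤m+n (gap m) (toGate m x))))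

to3via0+to3≡⇒OnGateGeodesic : ∀ m {x} → to3via0 m x + to3 m x ≡ gap m + gap m → OnGateGeodesic m x
to3via0+to3≡⇒OnGateGeodesic m {x} e = ≤-antisym to3+toGate≤gap (gap≤to3+toGate m x)
  where
  open ≤-Reasoning
  to3+toGate≤gap : to3 m x + toGate m x ≤ gap m
  to3+toGate≤gap = +-cancelˡ-≤ (gap m) _ _ (begin
    gap m + (to3 m x + toGate m x) ≡⟨ cong (gap m +_) (+-comm (to3 m x) (toGate m x)) ⟩
    gap m + (toGate m x + to3 m x) ≡⟨ +-assoc (gap m) (toGate m x) (to3 m x) ⟨
    (gap m + toGate m x) + to3 m x ≤⟨ +-monoˡ-≤ (to3 m x) (m≤n⊔m (to3 m x) (gap m + toGate m x)) ⟩
    to3via0 m x + to3 m x          ≡⟨ e ⟩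
    gap m + gap m ∎)

OnGateGeodesic⇒to3via0+to3≡ : ∀ m {x} → OnGateGeodesic m x → to3via0 m x + to3 m x ≡ gap m + gap m
OnGateGeodesic⇒to3via0+to3≡ m {x} on = begin
  to3via0 m x + to3 m x           ≡⟨ cong (_+ to3 m x) (OnGateGeodesic⇒to3via0 m on) ⟩
  (gap m + toGate m x) + to3 m x  ≡⟨ +-assoc (gap m) _ _ ⟩
  gap m + (toGate m x + to3 m x)  ≡⟨ cong (gap m +_) (trans (+-comm (toGate m x) (to3 m x)) on) ⟩
  gap m + gap m                   ∎
  where open ≡-Reasoning

-- Lipschitz bounds

Lipschitz : ∀ {m} → (Str m → ℕ) → Set
Lipschitz {m} f = ∀ {k} {p q : Str m} → IsState p → MoveAt k p q → f q ≤ suc (f p)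

Lipschitz-unsnoc : ∀ {m} (f : Digit × Str m → ℕ) →
  (∀ t {k x y} → IsState x → MoveAt k x y → f (t , y) ≤ suc (f (t , x))) →
  (∀ {x u v} → TopMove x u v → f (v , x) ≤ suc (f (u , x))) →
  Lipschitz (λ p → f (unsnoc p))
Lipschitz-unsnoc {m} f lowMoves topMoves {p = p} {q} st mv = go (MoveAt-decompose p q st mv) (IsState-init p st)
  where
  go : ∀ {c P Q} → Move⁺ m c P Q → IsState (proj₂ P) → f Q ≤ suc (f P)
  go (low _ refl mv) st = lowMoves _ st mv
  go (top refl tm)   _  = topMoves tm

+-≤suc : ∀ c {x y} → y ≤ suc x → c + y ≤ suc (c + x)
+-≤suc c {x} y≤1+x = ≤-trans (+-monoʳ-≤ c y≤1+x) (≤-reflexive (+-suc c x))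

≤2+ : ∀ {x y} → x ≤ y → x ≤ 2 + y
≤2+ x≤y = m≤n⇒m≤1+n (m≤n⇒m≤1+n x≤y)

mutual
  to3-Lipschitz : ∀ m → Lipschitz (to3 m)
  to3-Lipschitz zero    {()}
  to3-Lipschitz (suc m) = Lipschitz-unsnoc (to3⁺ m) lowMoves topMoves
    where
    lowMoves : ∀ t {k x y} → IsState x → MoveAt k x y → to3⁺ m (t , y) ≤ suc (to3⁺ m (t , x))
    lowMoves zero                   st mv = +-≤suc (gap (suc m)) (to3-Lipschitz m st mv)
    lowMoves (suc zero)             st mv = s≤s (s≤s (to3via0-Lipschitz m st mv))
    lowMoves (suc (suc zero))       st mv = s≤s (to3-Lipschitz m st mv)
    lowMoves (suc (suc (suc zero))) st mv = z≤n
    topMoves : ∀ {x u v} → TopMove x u v → to3⁺ m (v , x) ≤ suc (to3⁺ m (u , x))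
    topMoves (zero , inj₁ (refl , refl) , refl) rewrite to3via0-threes m | to3-threes m =
      s≤s (s≤s (≤2+ (m≤m+n _ 0)))
    topMoves (zero , inj₂ (refl , refl) , refl) rewrite to3via0-threes m | to3-threes m =
      s≤s (s≤s (s≤s (≤-reflexive (+-identityʳ _))))
    topMoves (suc zero , inj₁ (refl , refl) , _) = s≤s (≤2+ (m≤m⊔n _ _))
    topMoves (suc zero , inj₂ (refl , refl) , z) = s≤s (s≤s (Lead0⇒to3via0≤to3 m z))
    topMoves (suc (suc zero) , inj₁ (refl , refl) , refl) = z≤n
    topMoves (suc (suc zero) , inj₂ (refl , refl) , refl) rewrite to3-threes m = ≤-refl

  toGate-Lipschitz : ∀ m → Lipschitz (toGate m)
  toGate-Lipschitz zero    {()}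
  toGate-Lipschitz (suc m) = Lipschitz-unsnoc (toGate⁺ m) lowMoves topMoves
    where
    lowMoves : ∀ t {k x y} → IsState x → MoveAt k x y → toGate⁺ m (t , y) ≤ suc (toGate⁺ m (t , x))
    lowMoves zero                   st mv = z≤n
    lowMoves (suc zero)             st mv = s≤s (to3-Lipschitz m st mv)
    lowMoves (suc (suc zero))       st mv = s≤s (s≤s (to3via0-Lipschitz m st mv))
    lowMoves (suc (suc (suc zero))) st mv = n≤1+n _
    topMoves : ∀ {x u v} → TopMove x u v → toGate⁺ m (v , x) ≤ suc (toGate⁺ m (u , x))
    topMoves (zero , inj₁ (refl , refl) , refl) rewrite to3-threes m = ≤-refl
    topMoves (zero , inj₂ (refl , refl) , refl) = z≤n
    topMoves (suc zero , inj₁ (refl , refl) , z) = s≤s (s≤s (Lead0⇒to3via0≤to3 m z))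
    topMoves (suc zero , inj₂ (refl , refl) , _) = s≤s (≤2+ (m≤m⊔n _ _))
    topMoves (suc (suc zero) , inj₁ (refl , refl) , refl) rewrite to3via0-threes m = ≤-refl
    topMoves (suc (suc zero) , inj₂ (refl , refl) , refl) rewrite to3via0-threes m = s≤s (s≤s (≤2+ ≤-refl))

  to3via0-Lipschitz : ∀ m → Lipschitz (to3via0 m)
  to3via0-Lipschitz m st mv = ⊔-mono-≤ (to3-Lipschitz m st mv) (+-≤suc (gap m) (toGate-Lipschitz m st mv))

from0-Lipschitz : ∀ m → Lipschitz (from0 m)
from0-Lipschitz zero    {()}
from0-Lipschitz (suc m) = Lipschitz-unsnoc (from0⁺ m) lowMoves topMoves
  where
  lowMoves : ∀ t {k x y} → IsState x → MoveAt k x y → from0⁺ m (t , y) ≤ suc (from0⁺ m (t , x))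
  lowMoves zero                   st mv = from0-Lipschitz m st mv
  lowMoves (suc zero)             st mv = s≤s (+-≤suc (span m) (to3-Lipschitz m st mv))
  lowMoves (suc (suc zero))       st mv = s≤s (s≤s (+-≤suc (span m) (to3via0-Lipschitz m st mv)))
  lowMoves (suc (suc (suc zero))) st mv = n≤1+n _
  topMoves : ∀ {x u v} → TopMove x u v → from0⁺ m (v , x) ≤ suc (from0⁺ m (u , x))
  topMoves (zero , inj₁ (refl , refl) , refl) rewrite to3-threes m | from0-threes m =
    s≤s (≤-reflexive (+-identityʳ _))
  topMoves (zero , inj₂ (refl , refl) , refl) rewrite to3-threes m | from0-threes m =
    ≤2+ (m≤m+n _ 0)
  topMoves (suc zero , inj₁ (refl , refl) , z) = s≤s (s≤s (+-monoʳ-≤ (span m) (Lead0⇒to3via0≤to3 m z)))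
  topMoves (suc zero , inj₂ (refl , refl) , _) = s≤s (≤2+ (+-monoʳ-≤ (span m) (m≤m⊔n _ _)))
  topMoves (suc (suc zero) , inj₁ (refl , refl) , refl) rewrite to3via0-threes m =
    s≤s (s≤s (s≤s (≤-reflexive (+-comm (gap m + gap m) (span m)))))
  topMoves (suc (suc zero) , inj₂ (refl , refl) , refl) rewrite to3via0-threes m =
    s≤s (s≤s (≤2+ (≤-reflexive (+-comm (span m) (gap m + gap m)))))

-- Geodesic steps

-- A step along a geodesic: with (f , g) the values of two distance functions, f grows by one while
-- f + g keeps the value c, so g drops by one.
record Climb (c : ℕ) (before after : ℕ × ℕ) : Set where
  constructor climb
  field
    rise       : proj₁ after ≡ suc (proj₁ before)
    sum-before : proj₁ before + proj₂ before ≡ c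
    sum-after  : proj₁ after + proj₂ after ≡ c

Climb-swap : ∀ {c f g f′ g′} → Climb c (f , g) (f′ , g′) → Climb c (g′ , f′) (g , f)
Climb-swap {c} {f} {g} {f′} {g′} (climb rise sum sum′) =
  climb (+-cancelˡ-≡ f _ _ (begin
          f + g         ≡⟨ trans sum (sym sum′) ⟩
          f′ + g′       ≡⟨ cong (_+ g′) rise ⟩
          suc (f + g′)  ≡⟨ +-suc f g′ ⟨
          f + suc g′    ∎))
        (trans (+-comm g′ f′) sum′) (trans (+-comm g f) sum)
  where open ≡-Reasoning

Climb-≢ : ∀ {c f g f′ g′} → Climb c (f , g) (f′ , g′) → g ≢ g′
Climb-≢ step e = 1+n≢n (trans (sym (Climb.rise (Climb-swap step))) e)

GateStep SolutionStep : ∀ m → Str m → Str m → Set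
GateStep     m x y = Climb (gap m) (to3 m x , toGate m x) (to3 m y , toGate m y)
SolutionStep m x y = Climb (span m) (from0 m x , to3 m x) (from0 m y , to3 m y)

GateStep⁺ SolutionStep⁺ : ∀ m → Digit × Str m → Digit × Str m → Set
GateStep⁺     m P Q = Climb (gap (suc m)) (to3⁺ m P , toGate⁺ m P) (to3⁺ m Q , toGate⁺ m Q)
SolutionStep⁺ m P Q = Climb (span (suc m)) (from0⁺ m P , to3⁺ m P) (from0⁺ m Q , to3⁺ m Q)

to3via0-rise⇒GateStep : ∀ m {x y} → OnGateGeodesic m x → OnGateGeodesic m y →
  to3via0 m y ≡ suc (to3via0 m x) → GateStep m y x
to3via0-rise⇒GateStep m {x} {y} on-x on-y up = Climb-swap (climb toGate-up (comm on-x) (comm on-y))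
  where
  comm : ∀ {z} → OnGateGeodesic m z → toGate m z + to3 m z ≡ gap m
  comm {z} on = trans (+-comm (toGate m z) (to3 m z)) on
  toGate-up : toGate m y ≡ suc (toGate m x)
  toGate-up = +-cancelˡ-≡ (gap m) _ _ (begin
    gap m + toGate m y       ≡⟨ OnGateGeodesic⇒to3via0 m on-y ⟨
    to3via0 m y              ≡⟨ up ⟩
    suc (to3via0 m x)        ≡⟨ cong suc (OnGateGeodesic⇒to3via0 m on-x) ⟩
    suc (gap m + toGate m x) ≡⟨ +-suc (gap m) (toGate m x) ⟨
    gap m + suc (toGate m x) ∎)
    where open ≡-Reasoning

GateStep-below : ∀ m → Digit → Str m → Str m → Set
GateStep-below m zero                   x y = ⊥
GateStep-below m (suc zero)             x y = GateStep m y x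
GateStep-below m (suc (suc zero))       x y = GateStep m x y
GateStep-below m (suc (suc (suc zero))) x y = ⊥

SolutionStep-below : ∀ m → Digit → Str m → Str m → Set
SolutionStep-below m zero                   x y = SolutionStep m x y
SolutionStep-below m (suc zero)             x y = GateStep m x y
SolutionStep-below m (suc (suc zero))       x y = GateStep m y x
SolutionStep-below m (suc (suc (suc zero))) x y = ⊥

GateStep⁺⇒below : ∀ m t {x y} → GateStep⁺ m (t , x) (t , y) → GateStep-below m t x y
GateStep⁺⇒below m zero (climb up _ sum-y) =
  m≢1+m+n (gap (suc m)) (trans (trans (sym sum-y) (+-identityʳ _)) up)
GateStep⁺⇒below m (suc zero) (climb up sum-x sum-y) =
  to3via0-rise⇒GateStep m (on sum-x) (on sum-y) (suc-injective (suc-injective up))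
  where
  on : ∀ {z} → 2 + to3via0 m z + (1 + to3 m z) ≡ gap (suc m) → OnGateGeodesic m z
  on e = to3via0+to3≡⇒OnGateGeodesic m (+-cancelˡ-≡ 3 _ _ (trans (sym (+-middle₁ _ _)) e))
GateStep⁺⇒below m (suc (suc zero)) (climb up sum-x sum-y) = climb (suc-injective up) (on sum-x) (on sum-y)
  where
  on : ∀ {z} → 1 + to3 m z + (2 + to3via0 m z) ≡ gap (suc m) → OnGateGeodesic m z
  on e = to3via0+to3≡⇒OnGateGeodesic m (+-cancelˡ-≡ 3 _ _ (trans (sym (+-middle₂ _ _)) e))
GateStep⁺⇒below m (suc (suc (suc zero))) (climb () _ _)

SolutionStep⁺⇒below : ∀ m t {x y} → SolutionStep⁺ m (t , x) (t , y) → SolutionStep-below m t x y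
SolutionStep⁺⇒below m zero (climb up sum-x sum-y) = climb up (on sum-x) (on sum-y)
  where
  on : ∀ {z} → from0 m z + (gap (suc m) + to3 m z) ≡ span (suc m) → from0 m z + to3 m z ≡ span m
  on {z} e =
    +-cancelˡ-≡ (gap (suc m)) _ _ (trans (x∙yz≈y∙xz +-commutativeSemigroup (gap (suc m)) (from0 m z) (to3 m z)) e)
SolutionStep⁺⇒below m (suc zero) (climb up sum-x sum-y) =
  climb (+-cancelˡ-≡ (span m) _ _ (trans (suc-injective up) (sym (+-suc (span m) _)))) (on sum-x) (on sum-y)
  where
  on : ∀ {z} → 1 + (span m + to3 m z) + (2 + to3via0 m z) ≡ span (suc m) → OnGateGeodesic m z
  on e = to3via0+to3≡⇒OnGateGeodesic m
           (+-cancelˡ-≡ 3 _ _ (+-cancelʳ-≡ (span m) _ _ (trans (sym (+-middle₁-span (span m) _ _)) e)))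
SolutionStep⁺⇒below m (suc (suc zero)) (climb up sum-x sum-y) =
  to3via0-rise⇒GateStep m (on sum-x) (on sum-y)
    (+-cancelˡ-≡ (span m) _ _ (trans (suc-injective (suc-injective up)) (sym (+-suc (span m) _))))
  where
  on : ∀ {z} → 2 + (span m + to3via0 m z) + (1 + to3 m z) ≡ span (suc m) → OnGateGeodesic m z
  on e = to3via0+to3≡⇒OnGateGeodesic m
           (+-cancelˡ-≡ 3 _ _ (+-cancelʳ-≡ (span m) _ _ (trans (sym (+-middle₂-span (span m) _ _)) e)))
SolutionStep⁺⇒below m (suc (suc (suc zero))) (climb up _ _) = 1+n≢n (sym up)

-- Positions of consecutive moves

record Near {n} (c c′ : Fin n) : Set where
  constructor near
  field
    distance≤1 : ∣ toℕ c - toℕ c′ ∣ ≤ 1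

Near-refl : ∀ {n} (c : Fin n) → Near c c
Near-refl c = near (≤-trans (≤-reflexive (∣n-n∣≡0 (toℕ c))) z≤n)

Near-sym : ∀ {n} {c c′ : Fin n} → Near c c′ → Near c′ c
Near-sym {c = c} {c′} (near d) = near (subst (_≤ 1) (∣-∣-comm (toℕ c) (toℕ c′)) d)

Near-inject₁ : ∀ {n} {k k′ : Fin n} → Near k k′ → Near (inject₁ k) (inject₁ k′)
Near-inject₁ {k = k} {k′} (near d) =
  near (subst₂ (λ a b → ∣ a - b ∣ ≤ 1) (sym (Fin.toℕ-inject₁ k)) (sym (Fin.toℕ-inject₁ k′)) d)

Near-inject₁-fromℕ : ∀ {n} {k : Fin n} → suc (toℕ k) ≡ n → Near (inject₁ k) (fromℕ n)
Near-inject₁-fromℕ {n} {k} e =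
  near (subst₂ (λ a b → ∣ a - b ∣ ≤ 1) (sym (Fin.toℕ-inject₁ k)) (trans e (sym (Fin.toℕ-fromℕ n)))
               (∣n-1+n∣≤1 (toℕ k)))
  where
  ∣n-1+n∣≤1 : ∀ n → ∣ n - suc n ∣ ≤ 1
  ∣n-1+n∣≤1 zero    = ≤-refl
  ∣n-1+n∣≤1 (suc n) = ∣n-1+n∣≤1 n

MoveAt-last≢ : ∀ {m} {c : Fin (suc m)} {p q : Str (suc m)} → MoveAt c p q → last p ≢ last q → toℕ c ≡ m
MoveAt-last≢ {m} {c} {p} {q} mv last≢ = go (view c) mv
  where
  go : ∀ {c} → View c → MoveAt c p q → toℕ c ≡ m
  go ‵fromℕ       _  = Fin.toℕ-fromℕ m
  go (‵inject₁ k) mv = ⊥-elim (last≢ (MoveAt-last mv))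

MoveAt-into-threes : ∀ m {k : Fin m} {x} → IsState x → MoveAt k x (threes m) → suc (toℕ k) ≡ m
MoveAt-into-threes zero    {()}
MoveAt-into-threes (suc m) {x = x} st mv = cong suc (MoveAt-last≢ mv last≢)
  where
  last≢ : last x ≢ last (threes (suc m))
  last≢ e = MoveAt-irrefl (subst (λ z → MoveAt _ z (threes (suc m)))
                                  (last≡3⇒threes x st (trans e (last-replicate m d3))) mv)

MoveAt-into-Lead0 : ∀ m {k : Fin m} {x y} → MoveAt k x y → Lead0 y → toGate m x ≢ toGate m y →
                    suc (toℕ k) ≡ m
MoveAt-into-Lead0 zero    {()}
MoveAt-into-Lead0 (suc m) mv z toGate≢ =
  cong suc (MoveAt-last≢ mv λ e →
    toGate≢ (trans (toGate-Lead0 (suc m) (trans e z)) (sym (toGate-Lead0 (suc m) z))))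

Middle : Digit → Set
Middle t = t ≡ d1 ⊎ t ≡ d2

TopMove-cases : ∀ {m} {x : Str m} {u v} → TopMove x u v → x ≡ threes m ⊎ (Lead0 x × Middle u × Middle v)
TopMove-cases (zero , _ , e)                     = inj₁ e
TopMove-cases (suc zero , inj₁ (refl , refl) , z) = inj₂ (z , inj₁ refl , inj₂ refl)
TopMove-cases (suc zero , inj₂ (refl , refl) , z) = inj₂ (z , inj₂ refl , inj₁ refl)
TopMove-cases (suc (suc zero) , _ , e)           = inj₁ e

-- A low move next to a move of the leading digit ends at (or leaves) 3…3 or a state with leading digit
-- 0, so it moves the digit just below the leading one; in the second case because it changes the
-- distance to the gate.
module _ {m} (Step : Digit × Str m → Digit × Str m → Set)
  (low-turn : ∀ t x y z {k k′} → IsState x → IsState y → IsState z → MoveAt k x y → MoveAt k′ y z →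
              Step (t , x) (t , y) → Step (t , y) (t , z) → Near k k′)
  (toGate-moves : ∀ {t} x y → Middle t → Step (t , x) (t , y) → toGate m x ≢ toGate m y)
  where

  private
    low-into-top : ∀ {k x y u v} → IsState x → MoveAt k x y → TopMove y u v →
                   (Middle u → toGate m x ≢ toGate m y) → suc (toℕ k) ≡ m
    low-into-top {k} {x} sx mv tm toGate≢ with TopMove-cases tm
    ... | inj₁ y≡3         = MoveAt-into-threes m sx (subst (MoveAt k x) y≡3 mv)
    ... | inj₂ (z , u , _) = MoveAt-into-Lead0 m mv z (toGate≢ u)

  turn⁺ : ∀ {c c′ P Q R} → IsState (proj₂ P) → IsState (proj₂ Q) → IsState (proj₂ R) →
          Move⁺ m c P Q → Move⁺ m c′ Q R → Step P Q → Step Q R → Near c c′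
  turn⁺ sx sy sz (low k refl mv) (low k′ refl mv′) step step′ =
    Near-inject₁ (low-turn _ _ _ _ sx sy sz mv mv′ step step′)
  turn⁺ sx _  _  (low k refl mv) (top refl tm) step _ =
    Near-inject₁-fromℕ (low-into-top sx mv tm λ u → toGate-moves _ _ u step)
  turn⁺ _  _  sz (top refl (a , pair , pre)) (low k refl mv) _ step′ =
    Near-sym (Near-inject₁-fromℕ (low-into-top sz (MoveAt-sym mv) (a , StepPair-sym pair , pre)
                                                λ v → ≢-sym (toGate-moves _ _ v step′)))
  turn⁺ _  _  _  (top refl _) (top refl _) _ _ = Near-refl (fromℕ m)

Turn : ∀ m → (Str m → Str m → Set) → Set
Turn m Step = ∀ {c c′} {p q s : Str m} → IsState p → IsState q → IsState s →
              MoveAt c p q → MoveAt c′ q s → Step p q → Step q s → Near c c′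

Turn-reverse : ∀ {m} {Step : Str m → Str m → Set} → Turn m Step →
  ∀ {c c′} {p q s : Str m} → IsState p → IsState q → IsState s →
  MoveAt c p q → MoveAt c′ q s → Step q p → Step s q → Near c c′
Turn-reverse turn sp sq ss mv mv′ step step′ =
  Near-sym (turn ss sq sp (MoveAt-sym mv′) (MoveAt-sym mv) step′ step)

GateStep-turn : ∀ m → Turn m (GateStep m)
GateStep-turn zero {()}
GateStep-turn (suc m) {p = p} {q} {s} sp sq ss mv mv′ =
  turn⁺ (GateStep⁺ m) low-turn toGate-moves (IsState-init p sp) (IsState-init q sq) (IsState-init s ss)
        (MoveAt-decompose p q sp mv) (MoveAt-decompose q s sq mv′)
  where
  low-turn : ∀ t x y z {k k′} → IsState x → IsState y → IsState z → MoveAt k x y → MoveAt k′ y z →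
             GateStep⁺ m (t , x) (t , y) → GateStep⁺ m (t , y) (t , z) → Near k k′
  low-turn t x y z {k} {k′} sx sy sz mv mv′ step step′ =
    below t (GateStep⁺⇒below m t step) (GateStep⁺⇒below m t step′)
    where
    below : ∀ t → GateStep-below m t x y → GateStep-below m t y z → Near k k′
    below zero                   ()
    below (suc zero)             = Turn-reverse (GateStep-turn m) sx sy sz mv mv′
    below (suc (suc zero))       = GateStep-turn m sx sy sz mv mv′
    below (suc (suc (suc zero))) ()
  toGate-moves : ∀ {t} x y → Middle t → GateStep⁺ m (t , x) (t , y) → toGate m x ≢ toGate m y
  toGate-moves _ _ (inj₁ refl) step = ≢-sym (Climb-≢ (GateStep⁺⇒below m d1 step))
  toGate-moves _ _ (inj₂ refl) step = Climb-≢ (GateStep⁺⇒below m d2 step)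

SolutionStep-turn : ∀ m → Turn m (SolutionStep m)
SolutionStep-turn zero {()}
SolutionStep-turn (suc m) {p = p} {q} {s} sp sq ss mv mv′ =
  turn⁺ (SolutionStep⁺ m) low-turn toGate-moves (IsState-init p sp) (IsState-init q sq) (IsState-init s ss)
        (MoveAt-decompose p q sp mv) (MoveAt-decompose q s sq mv′)
  where
  low-turn : ∀ t x y z {k k′} → IsState x → IsState y → IsState z → MoveAt k x y → MoveAt k′ y z →
             SolutionStep⁺ m (t , x) (t , y) → SolutionStep⁺ m (t , y) (t , z) → Near k k′
  low-turn t x y z {k} {k′} sx sy sz mv mv′ step step′ =
    below t (SolutionStep⁺⇒below m t step) (SolutionStep⁺⇒below m t step′)
    where
    below : ∀ t → SolutionStep-below m t x y → SolutionStep-below m t y z → Near k k′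
    below zero                   = SolutionStep-turn m sx sy sz mv mv′
    below (suc zero)             = GateStep-turn m sx sy sz mv mv′
    below (suc (suc zero))       = Turn-reverse (GateStep-turn m) sx sy sz mv mv′
    below (suc (suc (suc zero))) ()
  toGate-moves : ∀ {t} x y → Middle t → SolutionStep⁺ m (t , x) (t , y) → toGate m x ≢ toGate m y
  toGate-moves _ _ (inj₁ refl) step = Climb-≢ (SolutionStep⁺⇒below m d1 step)
  toGate-moves _ _ (inj₂ refl) step = ≢-sym (Climb-≢ (SolutionStep⁺⇒below m d2 step))

-- An explicit solution with span n moves

MoveAt-∷ʳ : ∀ {m} {k : Fin m} {x y : Str m} t → MoveAt k x y → MoveAt (inject₁ k) (x ∷ʳ t) (y ∷ʳ t)
MoveAt-∷ʳ {m} {k} {x} {y} t (same , a , pair , rc) =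
  (λ j j≢k → go (view j) j≢k) ,
  a , subst₂ (StepPair a) (sym (lookup-∷ʳ-inject₁ x t k)) (sym (lookup-∷ʳ-inject₁ y t k)) pair ,
  raiseRightCond k rc
  where
  go : ∀ {j} → View j → j ≢ inject₁ k → lookup (x ∷ʳ t) j ≡ lookup (y ∷ʳ t) j
  go ‵fromℕ       _    = trans (lookup-∷ʳ-fromℕ x t) (sym (lookup-∷ʳ-fromℕ y t))
  go (‵inject₁ j) j≢k =
    trans (lookup-∷ʳ-inject₁ x t j) (trans (same j (j≢k ∘ cong inject₁)) (sym (lookup-∷ʳ-inject₁ y t j)))
  raiseRightCond : ∀ k → RightCond x k a → RightCond (x ∷ʳ t) (inject₁ k) a
  raiseRightCond zero    _  = tt
  raiseRightCond (suc k) rc rewrite lookup-∷ʳ-inject₁ x t (inject₁ k) = rc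

MoveAt-∷ʳ-top : ∀ {m} {x : Str m} {u v} → TopMove x u v → MoveAt (fromℕ m) (x ∷ʳ u) (x ∷ʳ v)
MoveAt-∷ʳ-top {m} {x} {u} {v} (a , pair , pre) =
  (λ j j≢top → go (view j) j≢top) ,
  a , subst₂ (StepPair a) (sym (lookup-∷ʳ-fromℕ x u)) (sym (lookup-∷ʳ-fromℕ x v)) pair ,
  rightCond m x a pre
  where
  go : ∀ {j} → View j → j ≢ fromℕ m → lookup (x ∷ʳ u) j ≡ lookup (x ∷ʳ v) j
  go ‵fromℕ       j≢top = ⊥-elim (j≢top refl)
  go (‵inject₁ j) _     = trans (lookup-∷ʳ-inject₁ x u j) (sym (lookup-∷ʳ-inject₁ x v j))
  below-top : ∀ m (x : Str (suc m)) → dig (x ∷ʳ u) (inject₁ (fromℕ m)) ≡ last x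
  below-top m x = trans (lookup-∷ʳ-inject₁ x u (fromℕ m)) (lookup-fromℕ x)
  rightCond : ∀ m (x : Str m) a → Precondition x a → RightCond (x ∷ʳ u) (fromℕ m) a
  rightCond zero    _ _                _    = tt
  rightCond (suc m) x zero             refl =
    (λ _ → trans (below-top m x) (last-replicate m d3)) , (λ odd → ⊥-elim (odd refl))
  rightCond (suc m) x (suc zero)       z    = (λ ()) , (λ _ → trans (below-top m x) z)
  rightCond (suc m) x (suc (suc zero)) refl =
    (λ _ → trans (below-top m x) (last-replicate m d3)) , (λ odd → ⊥-elim (odd refl))

threes-OnGateGeodesic : ∀ m → OnGateGeodesic m (threes m)
threes-OnGateGeodesic m rewrite to3-threes m | toGate-threes m = refl

gate-Lead0 : ∀ m → Lead0 (gate m)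
gate-Lead0 zero    = tt
gate-Lead0 (suc m) = last-∷ʳ d0 (threes m)

gate-IsState : ∀ m → IsState (gate m)
gate-IsState zero    ()
gate-IsState (suc m) = IsState-∷ʳ (threes m) d0 (threes-IsState m) λ ()

to3-gate : ∀ m → to3 m (gate m) ≡ gap m
to3-gate zero    = refl
to3-gate (suc m) rewrite unsnoc-∷ʳ (threes m) d0 | to3-threes m = +-identityʳ _

toGate-gate : ∀ m → toGate m (gate m) ≡ 0
toGate-gate m = toGate-Lead0 m (gate-Lead0 m)

gate-OnGateGeodesic : ∀ m → OnGateGeodesic m (gate m)
gate-OnGateGeodesic m rewrite to3-gate m | toGate-gate m = +-identityʳ _

to3via0-gate : ∀ m → to3via0 m (gate m) ≡ gap m
to3via0-gate m rewrite to3-gate m | toGate-gate m | +-identityʳ (gap m) = ⊔-idem (gap m)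

OnGateGeodesic-d1 : ∀ m {x} → OnGateGeodesic m x → to3⁺ m (d1 , x) + toGate⁺ m (d1 , x) ≡ gap (suc m)
OnGateGeodesic-d1 m on = trans (+-middle₁ _ _) (cong (3 +_) (OnGateGeodesic⇒to3via0+to3≡ m on))

OnGateGeodesic-d2 : ∀ m {x} → OnGateGeodesic m x → to3⁺ m (d2 , x) + toGate⁺ m (d2 , x) ≡ gap (suc m)
OnGateGeodesic-d2 m on = trans (+-middle₂ _ _) (cong (3 +_) (OnGateGeodesic⇒to3via0+to3≡ m on))

to3via0-fall : ∀ m {x y} → GateStep m x y → to3via0 m x ≡ suc (to3via0 m y)
to3via0-fall m {x} {y} step@(climb _ on-x on-y) = begin
  to3via0 m x              ≡⟨ OnGateGeodesic⇒to3via0 m on-x ⟩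
  gap m + toGate m x       ≡⟨ cong (gap m +_) (Climb.rise (Climb-swap step)) ⟩
  gap m + suc (toGate m y) ≡⟨ +-suc (gap m) (toGate m y) ⟩
  suc (gap m + toGate m y) ≡⟨ cong suc (OnGateGeodesic⇒to3via0 m on-y) ⟨
  suc (to3via0 m y)        ∎
  where open ≡-Reasoning

GateStep-raise₁ : ∀ m {x y} → GateStep m x y → GateStep⁺ m (d1 , y) (d1 , x)
GateStep-raise₁ m step@(climb _ on-x on-y) =
  climb (cong (2 +_) (to3via0-fall m step)) (OnGateGeodesic-d1 m on-y) (OnGateGeodesic-d1 m on-x)

GateStep-raise₂ : ∀ m {x y} → GateStep m x y → GateStep⁺ m (d2 , x) (d2 , y)
GateStep-raise₂ m (climb rise on-x on-y) =
  climb (cong suc rise) (OnGateGeodesic-d2 m on-x) (OnGateGeodesic-d2 m on-y)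

record Edge {m} (R : Str m → Str m → Set) (x y : Str m) : Set where
  constructor edge
  field
    source-state : IsState x
    target-state : IsState y
    adjacent     : Adjacent x y
    related      : R x y

Edge-raise : ∀ {m} {R : Str m → Str m → Set} {S : Str (suc m) → Str (suc m) → Set} t → t ≢ d3 →
  (∀ {x y} → R x y → S (x ∷ʳ t) (y ∷ʳ t)) → ∀ {x y} → Edge R x y → Edge S (x ∷ʳ t) (y ∷ʳ t)
Edge-raise t t≢3 raise {x} {y} (edge sx sy (k , mv) r) =
  edge (IsState-∷ʳ x t sx t≢3) (IsState-∷ʳ y t sy t≢3) (inject₁ k , MoveAt-∷ʳ {x = x} {y} t mv) (raise r)

Edge-flip : ∀ {m} {R : Str m → Str m → Set} {x y} → Edge R x y → Edge (λ u v → R v u) y x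
Edge-flip (edge sx sy (k , mv) r) = edge sy sx (k , MoveAt-sym mv) r

gmap-reverse : ∀ {A B : Set} {T : A → A → Set} {U : B → B → Set} (f : A → B) →
  (∀ {x y} → T x y → U (f y) (f x)) → ∀ {x y} → Star T x y → Star U (f y) (f x)
gmap-reverse {U = U} f g p = Star.reverse {T = λ a b → U b a} (λ u → u) (gmap f g p)

vertices : ∀ {A : Set} {R : A → A → Set} {x y} → Star R x y → List A
vertices {x = x} ε       = x ∷ []
vertices {x = x} (_ ◅ p) = x ∷ vertices p

vertices-Linked : ∀ {A : Set} {R : A → A → Set} {x y} (p : Star R x y) → Linked R (vertices p)
vertices-Linked ε               = [-]
vertices-Linked (e ◅ ε)         = e ∷ [-]
vertices-Linked (e ◅ p@(_ ◅ _)) = e ∷ vertices-Linked p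

vertices-head : ∀ {A : Set} {R : A → A → Set} {x y} (p : Star R x y) → List.head (vertices p) ≡ just x
vertices-head ε       = refl
vertices-head (_ ◅ _) = refl

vertices-last : ∀ {A : Set} {R : A → A → Set} {x y} (p : Star R x y) → List.last (vertices p) ≡ just y
vertices-last ε               = refl
vertices-last (_ ◅ ε)         = refl
vertices-last (_ ◅ p@(_ ◅ _)) = vertices-last p

GateStep-∷ʳ : ∀ {m} x t y t′ → GateStep⁺ m (t , x) (t′ , y) → GateStep (suc m) (x ∷ʳ t) (y ∷ʳ t′)
GateStep-∷ʳ {m} x t y t′ = subst₂ (GateStep⁺ m) (sym (unsnoc-∷ʳ x t)) (sym (unsnoc-∷ʳ y t′))

threes-∷ʳ-IsState : ∀ m → IsState (threes m ∷ʳ d3)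
threes-∷ʳ-IsState m = subst IsState (replicate-∷ʳ m d3) (threes-IsState (suc m))

-- 3 3…3 → 2 3…3 ⇝ 2 0 3…3 → 1 0 3…3 ⇝ 1 3…3 → 0 3…3, both ⇝ along gate-path m.
gate-path : ∀ m → Star (Edge (GateStep m)) (threes m) (gate m)
gate-path zero    = ε
gate-path (suc m) = subst (λ x → Star (Edge (GateStep (suc m))) x (gate (suc m))) (sym (replicate-∷ʳ m d3))
  (  edge (threes-∷ʳ-IsState m) (IsState-∷ʳ (threes m) d2 (threes-IsState m) λ ())
          (fromℕ m , MoveAt-∷ʳ-top (suc (suc zero) , inj₂ (refl , refl) , refl))
          (GateStep-∷ʳ (threes m) d3 (threes m) d2 3→2)
   ◅ gmap (_∷ʳ d2) (Edge-raise d2 (λ ()) λ {x} {y} step → GateStep-∷ʳ x d2 y d2 (GateStep-raise₂ m step))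
          (gate-path m)
  ◅◅ edge (IsState-∷ʳ (gate m) d2 (gate-IsState m) λ ()) (IsState-∷ʳ (gate m) d1 (gate-IsState m) λ ())
          (fromℕ m , MoveAt-∷ʳ-top (suc zero , inj₂ (refl , refl) , gate-Lead0 m))
          (GateStep-∷ʳ (gate m) d2 (gate m) d1 2→1)
   ◅ gmap-reverse (_∷ʳ d1)
          (λ e → Edge-raise d1 (λ ()) (λ {x} {y} step → GateStep-∷ʳ x d1 y d1 (GateStep-raise₁ m step))
                            (Edge-flip e))
          (gate-path m)
  ◅◅ edge (IsState-∷ʳ (threes m) d1 (threes-IsState m) λ ())
          (IsState-∷ʳ (threes m) d0 (threes-IsState m) λ ())
          (fromℕ m , MoveAt-∷ʳ-top (zero , inj₂ (refl , refl) , refl))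
          (GateStep-∷ʳ (threes m) d1 (threes m) d0 1→0)
   ◅ ε)
  where
  3→2 : GateStep⁺ m (d3 , threes m) (d2 , threes m)
  3→2 = climb (cong suc (to3-threes m)) refl (OnGateGeodesic-d2 m (threes-OnGateGeodesic m))
  2→1 : GateStep⁺ m (d2 , gate m) (d1 , gate m)
  2→1 = climb (cong (2 +_) (trans (to3via0-gate m) (sym (to3-gate m))))
              (OnGateGeodesic-d2 m (gate-OnGateGeodesic m)) (OnGateGeodesic-d1 m (gate-OnGateGeodesic m))
  1→0 : GateStep⁺ m (d1 , threes m) (d0 , threes m)
  1→0 = climb (trans (cong (gap (suc m) +_) (to3-threes m))
                     (trans (+-identityʳ _) (cong (3 +_) (sym (to3via0-threes m)))))
              (OnGateGeodesic-d1 m (threes-OnGateGeodesic m))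
              (trans (+-identityʳ _) (trans (cong (gap (suc m) +_) (to3-threes m)) (+-identityʳ _)))

Rises : ∀ {m} → (Str m → ℕ) → Str m → Str m → Set
Rises f x y = f y ≡ suc (f x)

from0-Rises-∷ʳ : ∀ {m} x t y t′ → from0⁺ m (t′ , y) ≡ suc (from0⁺ m (t , x)) →
                 Rises (from0 (suc m)) (x ∷ʳ t) (y ∷ʳ t′)
from0-Rises-∷ʳ {m} x t y t′ e =
  trans (cong (from0⁺ m) (unsnoc-∷ʳ y t′)) (trans e (cong (suc ∘ from0⁺ m) (sym (unsnoc-∷ʳ x t))))

-- 0…0 ⇝ 0 3…3 → 1 3…3 ⇝ 1 0 3…3 → 2 0 3…3 ⇝ 2 3…3 → 3 3…3.
solution-path : ∀ m → Star (Edge (Rises (from0 m))) (zeros m) (threes m)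
solution-path zero    = ε
solution-path (suc m) =
  subst₂ (Star (Edge (Rises (from0 (suc m))))) (sym (replicate-∷ʳ m d0)) (sym (replicate-∷ʳ m d3))
  (  gmap (_∷ʳ d0) (Edge-raise d0 (λ ()) λ {x} {y} rise → from0-Rises-∷ʳ x d0 y d0 rise) (solution-path m)
  ◅◅ edge (IsState-∷ʳ (threes m) d0 (threes-IsState m) λ ())
          (IsState-∷ʳ (threes m) d1 (threes-IsState m) λ ())
          (fromℕ m , MoveAt-∷ʳ-top (zero , inj₁ (refl , refl) , refl))
          (from0-Rises-∷ʳ (threes m) d0 (threes m) d1 0→1)
   ◅ gmap (_∷ʳ d1) (Edge-raise d1 (λ ()) λ {x} {y} step → from0-Rises-∷ʳ x d1 y d1 (rise₁ step)) (gate-path m)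
  ◅◅ edge (IsState-∷ʳ (gate m) d1 (gate-IsState m) λ ()) (IsState-∷ʳ (gate m) d2 (gate-IsState m) λ ())
          (fromℕ m , MoveAt-∷ʳ-top (suc zero , inj₁ (refl , refl) , gate-Lead0 m))
          (from0-Rises-∷ʳ (gate m) d1 (gate m) d2 1→2)
   ◅ gmap-reverse (_∷ʳ d2)
          (λ e → Edge-raise d2 (λ ()) (λ {x} {y} step → from0-Rises-∷ʳ x d2 y d2 (rise₂ step))
                            (Edge-flip e))
          (gate-path m)
  ◅◅ edge (IsState-∷ʳ (threes m) d2 (threes-IsState m) λ ()) (threes-∷ʳ-IsState m)
          (fromℕ m , MoveAt-∷ʳ-top (suc (suc zero) , inj₁ (refl , refl) , refl))
          (from0-Rises-∷ʳ (threes m) d2 (threes m) d3 2→3)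
   ◅ ε)
  where
  rise₁ : ∀ {x y} → GateStep m x y → from0⁺ m (d1 , y) ≡ suc (from0⁺ m (d1 , x))
  rise₁ {x} (climb rise _ _) = cong suc (trans (cong (span m +_) rise) (+-suc (span m) (to3 m x)))
  rise₂ : ∀ {x y} → GateStep m y x → from0⁺ m (d2 , y) ≡ suc (from0⁺ m (d2 , x))
  rise₂ {x} step = cong (2 +_) (trans (cong (span m +_) (to3via0-fall m step)) (+-suc (span m) (to3via0 m x)))
  0→1 : from0⁺ m (d1 , threes m) ≡ suc (from0⁺ m (d0 , threes m))
  0→1 = cong suc (trans (cong (span m +_) (to3-threes m)) (trans (+-identityʳ _) (sym (from0-threes m))))
  1→2 : from0⁺ m (d2 , gate m) ≡ suc (from0⁺ m (d1 , gate m))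
  1→2 = cong (λ a → 2 + (span m + a)) (trans (to3via0-gate m) (sym (to3-gate m)))
  2→3 : from0⁺ m (d3 , threes m) ≡ suc (from0⁺ m (d2 , threes m))
  2→3 = cong (3 +_) (trans (+-comm (gap m + gap m) (span m)) (cong (span m +_) (sym (to3via0-threes m))))

vertices-states : ∀ {m} {R : Str m → Str m → Set} {x y} (p : Star (Edge R) x y) →
                  IsState x → All IsState (vertices p)
vertices-states ε                    sx = sx ∷ []
vertices-states (edge _ sy _ _ ◅ p) sx = sx ∷ vertices-states p sy

vertices-length : ∀ {m} {f : Str m → ℕ} {x y} (p : Star (Edge (Rises f)) x y) →
                  length (vertices p) + f x ≡ suc (f y)
vertices-length ε = refl
vertices-length {f = f} {x} (edge _ _ _ rise ◅ p) =
  trans (sym (+-suc (length (vertices p)) (f x)))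
        (trans (cong (length (vertices p) +_) (sym rise)) (vertices-length p))

path-Solution : ∀ n (p : Star (Edge (Rises (from0 n))) (zeros n) (threes n)) → Solution n (vertices p)
path-Solution n p = record
  { states   = vertices-states p (zeros-IsState n)
  ; distinct = AllPairs.map (λ lt e → <-irrefl (cong (from0 n) e) lt)
                 (Linked⇒AllPairs {R = λ x y → from0 n x < from0 n y} <-trans
                   (Linked.map (λ e → ≤-reflexive (sym (Edge.related e))) (vertices-Linked p)))
  ; steps    = Linked.map Edge.adjacent (vertices-Linked p)
  ; start    = vertices-head p
  ; finish   = vertices-last p
  }

shortest-length≤ : ∀ n {s} → Shortest n s → length s ≤ suc (span n)
shortest-length≤ n (_ , shortest) = ≤-trans (shortest _ (path-Solution n path)) (≤-reflexive length≡)
  where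
  path = solution-path n
  length≡ : length (vertices path) ≡ suc (span n)
  length≡ = begin
    length (vertices path)                   ≡⟨ +-identityʳ _ ⟨
    length (vertices path) + 0               ≡⟨ cong (length (vertices path) +_) (from0-zeros n) ⟨
    length (vertices path) + from0 n (zeros n) ≡⟨ vertices-length path ⟩
    suc (from0 n (threes n))                 ≡⟨ cong suc (from0-threes n) ⟩
    suc (span n)                             ∎
    where open ≡-Reasoning

-- The shortest solution runs along a geodesic

walk-bounds : ∀ {n} (f : Str n → ℕ) → Lipschitz f →
  ∀ x xs {y} → Linked Adjacent (x ∷ xs) → All IsState (x ∷ xs) → List.last (x ∷ xs) ≡ just y →
  f y ≤ f x + length xs × f x ≤ f y + length xs
walk-bounds f lip x [] _ _ refl = m≤m+n (f x) 0 , m≤m+n (f x) 0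
walk-bounds f lip x (x′ ∷ xs) ((_ , mv) ∷ linked) (sx ∷ states@(sx′ ∷ _)) last≡
  with walk-bounds f lip x′ xs linked states last≡
... | forward , backward =
  ≤-trans forward (≤-trans (+-monoˡ-≤ (length xs) (lip sx mv)) (≤-reflexive (sym (+-suc (f x) (length xs))))) ,
  ≤-trans (lip sx′ (MoveAt-sym mv)) (≤-trans (s≤s backward) (≤-reflexive (sym (+-suc _ (length xs)))))

pinned : ∀ {b a i j S} → b ≤ i → S ≤ b + j → S ≤ a + i → a ≤ j → i + j ≤ S → b ≡ i × b + a ≡ S
pinned {b} {a} {i} {j} {S} b≤i S≤b+j S≤a+i a≤j i+j≤S = b≡i , trans (cong₂ _+_ b≡i a≡j) i+j≡S
  where
  b≡i : b ≡ i
  b≡i = ≤-antisym b≤i (+-cancelʳ-≤ j i b (≤-trans i+j≤S S≤b+j))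
  a≡j : a ≡ j
  a≡j = ≤-antisym a≤j (+-cancelʳ-≤ i j a (≤-trans (≤-reflexive (+-comm j i)) (≤-trans i+j≤S S≤a+i)))
  i+j≡S : i + j ≡ S
  i+j≡S = ≤-antisym i+j≤S (≤-trans S≤b+j (≤-reflexive (cong (_+ j) b≡i)))

-- The bounds relating x to the start 0…0, i steps back, are passed in; those relating it to the end
-- 3…3 come from the rest of the walk.
pinned-vertex : ∀ n i x xs →
  Linked Adjacent (x ∷ xs) → All IsState (x ∷ xs) → List.last (x ∷ xs) ≡ just (threes n) →
  from0 n x ≤ i → span n ≤ to3 n x + i → i + length xs ≤ span n →
  from0 n x ≡ i × from0 n x + to3 n x ≡ span n
pinned-vertex n i x xs linked states last≡ from0≤i span≤to3+i length≤ =
  pinned from0≤i (subst (_≤ from0 n x + length xs) (from0-threes n) (proj₁ from0-bounds)) span≤to3+i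
         (subst (to3 n x ≤_) (cong (_+ length xs) (to3-threes n)) (proj₂ to3-bounds)) length≤
  where
  from0-bounds = walk-bounds (from0 n) (from0-Lipschitz n) x xs linked states last≡
  to3-bounds   = walk-bounds (to3 n) (to3-Lipschitz n) x xs linked states last≡

shortest-walk : ∀ n i x xs →
  Linked Adjacent (x ∷ xs) → All IsState (x ∷ xs) → List.last (x ∷ xs) ≡ just (threes n) →
  from0 n x ≤ i → span n ≤ to3 n x + i → i + length xs ≤ span n → Linked (SolutionStep n) (x ∷ xs)
shortest-walk n i x [] _ _ _ _ _ _ = [-]
shortest-walk n i x (y ∷ ys) linked@((_ , mv) ∷ linked′) states@(sx ∷ states′@(sy ∷ _))
              last≡ from0≤i span≤to3+i length≤ =
  climb (trans at-y (cong suc (sym at-x))) on-x on-y ∷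
  shortest-walk n (suc i) y ys linked′ states′ last≡ from0≤1+i span≤ length≤′
  where
  x-pinned = pinned-vertex n i x (y ∷ ys) linked states last≡ from0≤i span≤to3+i length≤
  at-x = proj₁ x-pinned
  on-x = proj₂ x-pinned
  from0≤1+i : from0 n y ≤ suc i
  from0≤1+i = ≤-trans (from0-Lipschitz n sx mv) (s≤s (≤-reflexive at-x))
  span≤ : span n ≤ to3 n y + suc i
  span≤ = ≤-trans span≤to3+i (≤-trans (+-monoˡ-≤ i (to3-Lipschitz n sy (MoveAt-sym mv)))
                                      (≤-reflexive (sym (+-suc (to3 n y) i))))
  length≤′ : suc i + length ys ≤ span n
  length≤′ = ≤-trans (≤-reflexive (sym (+-suc i (length ys)))) length≤
  y-pinned = pinned-vertex n (suc i) y ys linked′ states′ last≡ from0≤1+i span≤ length≤′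
  at-y = proj₁ y-pinned
  on-y = proj₂ y-pinned

shortest-geodesic : ∀ n {s} → Shortest n s → Linked (SolutionStep n) s
shortest-geodesic n {[]}     _                  = []
shortest-geodesic n {x ∷ xs} short@(solution , _) with Solution.start solution
... | refl =
  shortest-walk n 0 x xs (Solution.steps solution) (Solution.states solution) (Solution.finish solution)
    (≤-reflexive (from0-zeros n)) (≤-reflexive (sym (trans (+-identityʳ _) (to3-zeros n))))
    (s≤s⁻¹ (shortest-length≤ n short))

Linked-++⁻ʳ : ∀ {A : Set} {R : A → A → Set} xs {ys} → Linked R (xs ++ ys) → Linked R ys
Linked-++⁻ʳ []       linked = linked
Linked-++⁻ʳ (_ ∷ xs) linked = Linked-++⁻ʳ xs (Linked.tail linked)

mainTheorem8 : (n : ℕ) → 1 ≤ n → (s : List (Str n)) → Shortest n s →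
    ∀ (pre post : List (Str n)) (p q r : Str n) → s ≡ pre ++ p ∷ q ∷ r ∷ post →
    ∀ (c c′ : Fin n) → MoveAt c p q → MoveAt c′ q r → ∣ toℕ c - toℕ c′ ∣ ≤ 1
mainTheorem8 n _ s short pre post p q r refl c c′ mv mv′
  with All.++⁻ʳ pre (Solution.states (proj₁ short)) | Linked-++⁻ʳ pre (shortest-geodesic n short)
... | sp ∷ sq ∷ sr ∷ _ | step ∷ step′ ∷ _ =
  Near.distance≤1 (SolutionStep-turn n sp sq sr mv mv′ step step′)
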